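{- Let $G=(V,E)$ be a connected finite simple graph with at least two vertices and with Cheeger constant $g$ (as defined in the context). If $k$ is a nonnegative integer with $k \le \frac{g|V|}{4+g}$, then $G$ cannot be cleared by $k$ lions: for every initial placement of $k$ lions on vertices of $G$ and every sequence of lion moves, there is no time $t$ with $C(t)=V$.
   Context: Lions and contamination model: a set of $k$ lions occupies vertices of a finite simple graph $G=(V,E)$ (several lions may share a vertex). Time is discrete, $t=0,1,2,\dots$. Between times $t$ and $t+1$ each lion either stays at its vertex or moves along an edge to an adjacent vertex. $C(t)\subseteq V$ denotes the set of cleared vertices at time $t$; all other vertices are contaminated. $C(0)$ is the set of vertices occupied by lions at time $0$. For $t\ge 0$, a vertex $v$ lies in $C(t+1)$ if and only if either $v$ is occupied by a lion at time $t+1$, or $v\in C(t)$ and for every vertex $u$ adjacent to $v$ with $u\notin C(t)$, some lion moves across the edge from $v$ to $u$ between times $t$ and $t+1$. The lions clear $G$ if $C(t)=V$ for some time $t$. For $S\subseteq V$, the boundary is $\partial S=\{v\in S : uv\in E \text{ for some } u\notin S\}$, and $\overline{S}=V\setminus S$. For a graph with at least two vertices, the Cheeger constant is $g=\min\left\{\frac{|\partial S|}{\min\{|S|,|\overline{S}|\}} : S\subseteq V,\ S\neq\emptyset,\ S\neq V\right\}$. -}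

module Defs where

open import Data.Nat as ℕ using (ℕ; zero; suc)
open import Data.Fin using (Fin)
open import Data.Fin.Subset using (Subset; ∣_∣; ∁; ⊥; ⊤; inside; outside)
open import Data.Bool using (Bool; true; false; _∧_; not)
open import Data.Vec using (tabulate; lookup)
open import Data.List using (allFin)
open import Data.Bool.ListAction using (any)
open import Data.Product using (Σ; ∃; _×_; _,_)
open import Data.Sum using (_⊎_)
open import Data.Integer using (+_)
open import Data.Rational as ℚ using (ℚ; 0ℚ; _≟_; _÷_; _≤_; _+_; _*_; ≢-nonZero)
open import Relation.Nullary using (¬_; yes; no)
open import Relation.Binary.PropositionalEquality using (_≡_; _≢_)

record Graph (n : ℕ) : Set where
  field
    adj    : Fin n → Fin n → Bool
    symm   : ∀ u v → adj u v ≡ adj v u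
    irrefl : ∀ v → adj v v ≡ false
open Graph public

data Reach {n : ℕ} (G : Graph n) : Fin n → Fin n → Set where
  here : ∀ {v} → Reach G v v
  step : ∀ {u w v} → adj G u w ≡ true → Reach G w v → Reach G u v

Connected : ∀ {n} → Graph n → Set
Connected {n} G = ∀ (u v : Fin n) → Reach G u v

boundary : ∀ {n} → Graph n → Subset n → Subset n
boundary {n} G S =
  tabulate λ v → lookup S v ∧ any (λ u → adj G v u ∧ not (lookup S u)) (allFin n)

-- rational a / b (b is positive in every use; b = 0 gives 0 by convention)
frac : ℕ → ℕ → ℚ
frac a zero    = 0ℚ
frac a (suc b) = (+ a) ℚ./ suc b

-- rational division p / q (q ≠ 0 in every use; q = 0 gives 0 by convention)
divℚ : ℚ → ℚ → ℚ
divℚ p q with q ≟ 0ℚ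
... | yes _  = 0ℚ
... | no q≢0 = _÷_ p q {{≢-nonZero q≢0}}

cheegerRatio : ∀ {n} → Graph n → Subset n → ℚ
cheegerRatio G S = frac ∣ boundary G S ∣ (ℕ._⊓_ ∣ S ∣ ∣ ∁ S ∣)

Proper : ∀ {n} → Subset n → Set
Proper S = S ≢ ⊥ × S ≢ ⊤

IsCheegerConstant : ∀ {n} → Graph n → ℚ → Set
IsCheegerConstant {n} G g =
  (Σ (Subset n) λ S → Proper S × cheegerRatio G S ≡ g)
  × (∀ (S : Subset n) → Proper S → g ≤ cheegerRatio G S)

Strategy : ℕ → ℕ → Set
Strategy n k = ℕ → Fin k → Fin n

ValidStrategy : ∀ {n k} → Graph n → Strategy n k → Set
ValidStrategy G pos =
  ∀ (t : ℕ) i → pos (suc t) i ≡ pos t i ⊎ adj G (pos t i) (pos (suc t) i) ≡ true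

Occupied : ∀ {n k} → Strategy n k → ℕ → Fin n → Set
Occupied pos t v = ∃ λ i → pos t i ≡ v

Cleared : ∀ {n k} → Graph n → Strategy n k → ℕ → Fin n → Set
Cleared G pos zero    v = Occupied pos zero v
Cleared {n} G pos (suc t) v =
  Occupied pos (suc t) v
  ⊎ (Cleared G pos t v
     × (∀ (u : Fin n) → adj G v u ≡ true → ¬ Cleared G pos t u →
          ∃ λ i → pos t i ≡ v × pos (suc t) i ≡ u))

ClearsAt : ∀ {n k} → Graph n → Strategy n k → ℕ → Set
ClearsAt {n} G pos t = ∀ (v : Fin n) → Cleared G pos t v

ℕtoℚ : ℕ → ℚ
ℕtoℚ a = (+ a) ℚ./ 1

{-# OPTIONS --safe #-}
module Submission where

-- Let m = ⌊n/2⌋. The bound on k rewrites as 4k ≤ g (n − k), so the Cheeger inequality gives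
-- 4k|S| ≤ |∂S| (n − k) whenever |S| ≤ n/2; for a single vertex this yields 2k ≤ m.
-- A vertex cleared at time t+1 is occupied at t+1, or was cleared at t and, if it lay on
-- ∂C(t), was occupied at t (a lion had to leave it towards a contaminated neighbour). Hence
-- |C(0)| ≤ k and |∂C(t)| + |C(t+1)| ≤ |C(t)| + 2k. If |C(t)| ≤ m < |C(t+1)|, the latter makes
-- |∂C(t)| too small for the expansion inequality at S = C(t); so by induction |C(t)| ≤ m < n
-- forever.

open import Defs

-- ℕ's arithmetic is opened only inside this block: the statement of mainTheorem1 uses ℚ's _+_ and _*_.
module _ where

  open import Data.Bool using (Bool; true; false; T)
  open import Data.Bool.Properties using (T-∧; T-≡; T-not-≡) renaming (_≟_ to _≟ᵇ_)
  open import Data.Fin using (Fin; zero; suc; fromℕ<)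
  open import Data.Fin.Properties using (any?; all?) renaming (_≟_ to _≟ᶠ_)
  open import Data.Fin.Subset using (Subset; ∣_∣; _∈_; _∉_; _⊆_; _∪_; _∩_; _─_; ⁅_⁆; ⊥; ⊤; ∁)
  open import Data.Fin.Subset.Properties
    using (_∈?_; ∣p∣≤∣x∷p∣; ∣⊥∣≡0; ∣⊤∣≡n; ∣⁅x⁆∣≡1; ∣∁p∣≡n∸∣p∣; x∈⁅x⁆; p⊆p∪q; q⊆p∪q; p⊆q⇒∣p∣≤∣q∣;
           x∈p∪q⁺; x∈p∩q⁺; x∈p∧x∉q⇒x∈p─q)
  open import Data.Integer as ℤ using (+_)
  import Data.Integer.Properties as ℤ
  open import Data.List using (allFin)
  open import Data.List.Relation.Unary.Any using (satisfied)
  open import Data.List.Relation.Unary.Any.Properties using (any⁻)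
  open import Data.Nat using (ℕ; zero; suc; _+_; _*_; _∸_; _⊓_; _≤_; _<_; _≤?_; z≤n; s≤s; z<s; ⌊_/2⌋)
  open import Data.Nat.Properties
  open import Data.Nat.Tactic.RingSolver using (solve-∀)
  open import Data.Product using (∃; _×_; _,_; proj₁; proj₂)
  open import Data.Rational as ℚ using (ℚ; 0ℚ; 1ℚ; toℚᵘ; NonZero; ≢-nonZero; nonNegative)
  import Data.Rational.Properties as ℚ
  open import Data.Rational.Unnormalised as ℚᵘ using (mkℚᵘ; *≤*; *≡*) renaming (_≃_ to _≃ᵘ_)
  import Data.Rational.Unnormalised.Properties as ℚᵘ
  open import Data.Sum using (inj₁; inj₂)
  open import Data.Vec using ([]; _∷_; lookup; tabulate)
  open import Data.Vec.Properties using ([]=⇒lookup; lookup⇒[]=; lookup∘tabulate)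
  open import Function using (_∘_; _⇔_; mk⇔; Equivalence)
  open import Relation.Nullary using (¬_; Dec; yes; no; isYes; contradiction)
  open import Relation.Nullary.Decidable using (_×-dec_; _⊎-dec_; _→-dec_; ¬?; toWitness; fromWitness)
  open import Relation.Binary.PropositionalEquality

  open Equivalence using (to; from)

  ∣p∪q∣≤∣p∣+∣q∣ : ∀ {n} (p q : Subset n) → ∣ p ∪ q ∣ ≤ ∣ p ∣ + ∣ q ∣
  ∣p∪q∣≤∣p∣+∣q∣ []          []          = z≤n
  ∣p∪q∣≤∣p∣+∣q∣ (true ∷ p)  (y ∷ q)     =
    s≤s (≤-trans (∣p∪q∣≤∣p∣+∣q∣ p q) (+-monoʳ-≤ ∣ p ∣ (∣p∣≤∣x∷p∣ y q)))
  ∣p∪q∣≤∣p∣+∣q∣ (false ∷ p) (true ∷ q)  =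
    ≤-trans (s≤s (∣p∪q∣≤∣p∣+∣q∣ p q)) (≤-reflexive (sym (+-suc ∣ p ∣ ∣ q ∣)))
  ∣p∪q∣≤∣p∣+∣q∣ (false ∷ p) (false ∷ q) = ∣p∪q∣≤∣p∣+∣q∣ p q

  ∣p─q∣+∣p∩q∣≡∣p∣ : ∀ {n} (p q : Subset n) → ∣ p ─ q ∣ + ∣ p ∩ q ∣ ≡ ∣ p ∣
  ∣p─q∣+∣p∩q∣≡∣p∣ []          []          = refl
  ∣p─q∣+∣p∩q∣≡∣p∣ (true ∷ p)  (true ∷ q)  = trans (+-suc _ _) (cong suc (∣p─q∣+∣p∩q∣≡∣p∣ p q))
  ∣p─q∣+∣p∩q∣≡∣p∣ (true ∷ p)  (false ∷ q) = cong suc (∣p─q∣+∣p∩q∣≡∣p∣ p q)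
  ∣p─q∣+∣p∩q∣≡∣p∣ (false ∷ p) (true ∷ q)  = ∣p─q∣+∣p∩q∣≡∣p∣ p q
  ∣p─q∣+∣p∩q∣≡∣p∣ (false ∷ p) (false ∷ q) = ∣p─q∣+∣p∩q∣≡∣p∣ p q

  x∈p⇔T[p[x]] : ∀ {n} {p : Subset n} {x : Fin n} → x ∈ p ⇔ T (lookup p x)
  x∈p⇔T[p[x]] {p = p} {x} = mk⇔ (from T-≡ ∘ []=⇒lookup) (lookup⇒[]= x p ∘ to T-≡)

  x∈tabulate⇔ : ∀ {n} (f : Fin n → Bool) {x : Fin n} → x ∈ tabulate f ⇔ T (f x)
  x∈tabulate⇔ f {x} = mk⇔
    (λ x∈ → subst T (lookup∘tabulate f x) (to x∈p⇔T[p[x]] x∈))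
    (λ fx → from x∈p⇔T[p[x]] (subst T (sym (lookup∘tabulate f x)) fx))

  image : ∀ {k n} → (Fin k → Fin n) → Subset n
  image {zero}  f = ⊥
  image {suc k} f = ⁅ f zero ⁆ ∪ image (f ∘ suc)

  ∣image∣≤ : ∀ {k n} (f : Fin k → Fin n) → ∣ image f ∣ ≤ k
  ∣image∣≤ {zero}  {n} f = ≤-reflexive (∣⊥∣≡0 n)
  ∣image∣≤ {suc k}     f = ≤-trans (∣p∪q∣≤∣p∣+∣q∣ ⁅ f zero ⁆ (image (f ∘ suc)))
    (+-mono-≤ (≤-reflexive (∣⁅x⁆∣≡1 (f zero))) (∣image∣≤ (f ∘ suc)))

  ∈-image : ∀ {k n} (f : Fin k → Fin n) i → f i ∈ image f
  ∈-image f zero    = p⊆p∪q (image (f ∘ suc)) (x∈⁅x⁆ (f zero))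
  ∈-image f (suc i) = q⊆p∪q ⁅ f zero ⁆ (image (f ∘ suc)) (∈-image (f ∘ suc) i)

  boundary⊆ : ∀ {n} (G : Graph n) (S : Subset n) → boundary G S ⊆ S
  boundary⊆ G S v∈∂S = from x∈p⇔T[p[x]] (proj₁ (to T-∧ (to (x∈tabulate⇔ _) v∈∂S)))

  ∈boundary⇒exit : ∀ {n} (G : Graph n) (S : Subset n) {v} → v ∈ boundary G S →
                   ∃ λ u → adj G v u ≡ true × u ∉ S
  ∈boundary⇒exit {n} G S v∈∂S
    with satisfied (any⁻ _ (allFin n) (proj₂ (to T-∧ (to (x∈tabulate⇔ _) v∈∂S))))
  ... | u , edge with to T-∧ edge
  ...   | vu , u∉S = u , to T-≡ vu , λ u∈S → subst T (to T-not-≡ u∉S) (to x∈p⇔T[p[x]] u∈S)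

  module Clearing {n k} (G : Graph n) (pos : Strategy n k) where

    cleared? : ∀ t v → Dec (Cleared G pos t v)
    cleared? zero    v = any? (λ i → pos zero i ≟ᶠ v)
    cleared? (suc t) v = any? (λ i → pos (suc t) i ≟ᶠ v) ⊎-dec
      (cleared? t v ×-dec all? λ u → (adj G v u ≟ᵇ true) →-dec (¬? (cleared? t u) →-dec
        any? λ i → (pos t i ≟ᶠ v) ×-dec (pos (suc t) i ≟ᶠ u)))

    C : ℕ → Subset n
    C t = tabulate (λ v → isYes (cleared? t v))

    ∈C⇔ : ∀ {t v} → v ∈ C t ⇔ Cleared G pos t v
    ∈C⇔ = mk⇔ (toWitness ∘ to (x∈tabulate⇔ _)) (from (x∈tabulate⇔ _) ∘ fromWitness)

    O : ℕ → Subset n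
    O t = image (pos t)

    occupied⇒∈O : ∀ {t v} → Occupied pos t v → v ∈ O t
    occupied⇒∈O {t} (i , refl) = ∈-image (pos t) i

    ∣O∣≤k : ∀ t → ∣ O t ∣ ≤ k
    ∣O∣≤k t = ∣image∣≤ (pos t)

    C0⊆O0 : C 0 ⊆ O 0
    C0⊆O0 v∈C = occupied⇒∈O (to ∈C⇔ v∈C)

    C-suc⊆interior∪O∪O : ∀ t → C (suc t) ⊆ (C t ─ boundary G (C t)) ∪ O t ∪ O (suc t)
    C-suc⊆interior∪O∪O t {v} v∈C with to ∈C⇔ v∈C
    ... | inj₁ occ = x∈p∪q⁺ (inj₂ (x∈p∪q⁺ (inj₂ (occupied⇒∈O occ))))
    ... | inj₂ (cl , guarded) with v ∈? boundary G (C t)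
    ...   | no v∉∂ = x∈p∪q⁺ (inj₁ (x∈p∧x∉q⇒x∈p─q (from ∈C⇔ cl) v∉∂))
    ...   | yes v∈∂ with ∈boundary⇒exit G (C t) v∈∂
    ...     | u , vu , u∉C with guarded u vu (u∉C ∘ from ∈C⇔)
    ...       | i , at-v , _ = x∈p∪q⁺ (inj₂ (x∈p∪q⁺ (inj₁ (occupied⇒∈O (i , at-v)))))

    ∣C0∣≤k : ∣ C 0 ∣ ≤ k
    ∣C0∣≤k = ≤-trans (p⊆q⇒∣p∣≤∣q∣ C0⊆O0) (∣O∣≤k 0)

    ∣∂C∣+∣C-suc∣≤∣C∣+2k : ∀ t → ∣ boundary G (C t) ∣ + ∣ C (suc t) ∣ ≤ ∣ C t ∣ + (k + k)
    ∣∂C∣+∣C-suc∣≤∣C∣+2k t = begin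
      ∣ ∂C ∣ + ∣ C (suc t) ∣                   ≤⟨ +-mono-≤ ∣∂C∣≤∣C∩∂C∣ ∣C-suc∣≤ ⟩
      ∣ C t ∩ ∂C ∣ + (∣ C t ─ ∂C ∣ + (k + k))  ≡⟨ shuffle ∣ C t ∩ ∂C ∣ ∣ C t ─ ∂C ∣ (k + k) ⟩
      (∣ C t ─ ∂C ∣ + ∣ C t ∩ ∂C ∣) + (k + k)  ≡⟨ cong (_+ (k + k)) (∣p─q∣+∣p∩q∣≡∣p∣ (C t) ∂C) ⟩
      ∣ C t ∣ + (k + k)                       ∎
      where
      open ≤-Reasoning
      ∂C = boundary G (C t)
      ∣∂C∣≤∣C∩∂C∣ : ∣ ∂C ∣ ≤ ∣ C t ∩ ∂C ∣
      ∣∂C∣≤∣C∩∂C∣ = p⊆q⇒∣p∣≤∣q∣ (λ v∈∂ → x∈p∩q⁺ (boundary⊆ G (C t) v∈∂ , v∈∂))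
      ∣C-suc∣≤ : ∣ C (suc t) ∣ ≤ ∣ C t ─ ∂C ∣ + (k + k)
      ∣C-suc∣≤ = begin
        ∣ C (suc t) ∣                             ≤⟨ p⊆q⇒∣p∣≤∣q∣ (C-suc⊆interior∪O∪O t) ⟩
        ∣ (C t ─ ∂C) ∪ O t ∪ O (suc t) ∣          ≤⟨ ∣p∪q∣≤∣p∣+∣q∣ (C t ─ ∂C) (O t ∪ O (suc t)) ⟩
        ∣ C t ─ ∂C ∣ + ∣ O t ∪ O (suc t) ∣        ≤⟨ +-monoʳ-≤ ∣ C t ─ ∂C ∣ (∣p∪q∣≤∣p∣+∣q∣ (O t) (O (suc t))) ⟩
        ∣ C t ─ ∂C ∣ + (∣ O t ∣ + ∣ O (suc t) ∣)  ≤⟨ +-monoʳ-≤ ∣ C t ─ ∂C ∣ (+-mono-≤ (∣O∣≤k t) (∣O∣≤k (suc t))) ⟩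
        ∣ C t ─ ∂C ∣ + (k + k)                    ∎
      shuffle : ∀ a b c → a + (b + c) ≡ (b + a) + c
      shuffle = solve-∀

  toℚᵘ-ℕtoℚ : ∀ a → toℚᵘ (ℕtoℚ a) ≃ᵘ mkℚᵘ (+ a) 0
  toℚᵘ-ℕtoℚ a = ℚ.toℚᵘ-fromℚᵘ (mkℚᵘ (+ a) 0)

  +a*1≡+a : ∀ a → + a ℤ.* + 1 ≡ + a
  +a*1≡+a a = ℤ.*-identityʳ (+ a)

  ℕtoℚ-cancel-≤ : ∀ {a b} → ℕtoℚ a ℚ.≤ ℕtoℚ b → a ≤ b
  ℕtoℚ-cancel-≤ {a} {b} a≤b
    with ℚᵘ.≤-respʳ-≃ (toℚᵘ-ℕtoℚ b) (ℚᵘ.≤-respˡ-≃ (toℚᵘ-ℕtoℚ a) (ℚ.toℚᵘ-mono-≤ a≤b))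
  ... | *≤* a*1≤b*1 rewrite +a*1≡+a a | +a*1≡+a b = ℤ.drop‿+≤+ a*1≤b*1

  ℕtoℚ-mono-≤ : ∀ {a b} → a ≤ b → ℕtoℚ a ℚ.≤ ℕtoℚ b
  ℕtoℚ-mono-≤ {a} {b} a≤b = ℚ.toℚᵘ-cancel-≤
    (ℚᵘ.≤-respʳ-≃ (ℚᵘ.≃-sym (toℚᵘ-ℕtoℚ b)) (ℚᵘ.≤-respˡ-≃ (ℚᵘ.≃-sym (toℚᵘ-ℕtoℚ a))
      (*≤* (subst₂ ℤ._≤_ (sym (+a*1≡+a a)) (sym (+a*1≡+a b)) (ℤ.+≤+ a≤b)))))

  ℕtoℚ-nonNeg : ∀ a → 0ℚ ℚ.≤ ℕtoℚ a
  ℕtoℚ-nonNeg a = ℕtoℚ-mono-≤ {0} {a} z≤n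

  ℕtoℚ-homo-+ : ∀ a b → ℕtoℚ (a + b) ≡ ℕtoℚ a ℚ.+ ℕtoℚ b
  ℕtoℚ-homo-+ a b = ℚ.toℚᵘ-injective (ℚᵘ.≃-trans (toℚᵘ-ℕtoℚ (a + b)) (ℚᵘ.≃-trans (*≡* integral)
    (ℚᵘ.≃-sym (ℚᵘ.≃-trans (ℚ.toℚᵘ-homo-+ (ℕtoℚ a) (ℕtoℚ b)) (ℚᵘ.+-cong (toℚᵘ-ℕtoℚ a) (toℚᵘ-ℕtoℚ b))))))
    where
    open ≡-Reasoning
    integral : + (a + b) ℤ.* + 1 ≡ (+ a ℤ.* + 1 ℤ.+ + b ℤ.* + 1) ℤ.* + 1
    integral = begin
      + (a + b) ℤ.* + 1                      ≡⟨ +a*1≡+a (a + b) ⟩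
      + (a + b)                              ≡⟨ ℤ.pos-+ a b ⟩
      + a ℤ.+ + b                            ≡⟨ cong₂ ℤ._+_ (+a*1≡+a a) (+a*1≡+a b) ⟨
      + a ℤ.* + 1 ℤ.+ + b ℤ.* + 1            ≡⟨ ℤ.*-identityʳ _ ⟨
      (+ a ℤ.* + 1 ℤ.+ + b ℤ.* + 1) ℤ.* + 1  ∎

  ℕtoℚ-homo-* : ∀ a b → ℕtoℚ (a * b) ≡ ℕtoℚ a ℚ.* ℕtoℚ b
  ℕtoℚ-homo-* a b = ℚ.toℚᵘ-injective (ℚᵘ.≃-trans (toℚᵘ-ℕtoℚ (a * b)) (ℚᵘ.≃-trans (*≡* integral)
    (ℚᵘ.≃-sym (ℚᵘ.≃-trans (ℚ.toℚᵘ-homo-* (ℕtoℚ a) (ℕtoℚ b)) (ℚᵘ.*-cong (toℚᵘ-ℕtoℚ a) (toℚᵘ-ℕtoℚ b))))))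
    where
    open ≡-Reasoning
    integral : + (a * b) ℤ.* + 1 ≡ (+ a ℤ.* + b) ℤ.* + 1
    integral = begin
      + (a * b) ℤ.* + 1      ≡⟨ +a*1≡+a (a * b) ⟩
      + (a * b)              ≡⟨ ℤ.pos-* a b ⟩
      + a ℤ.* + b            ≡⟨ ℤ.*-identityʳ _ ⟨
      (+ a ℤ.* + b) ℤ.* + 1  ∎

  frac-*-cancel : ∀ b μ → frac b (suc μ) ℚ.* ℕtoℚ (suc μ) ≡ ℕtoℚ b
  frac-*-cancel b μ = ℚ.toℚᵘ-injective (ℚᵘ.≃-trans (ℚ.toℚᵘ-homo-* (frac b (suc μ)) (ℕtoℚ (suc μ)))
    (ℚᵘ.≃-trans (ℚᵘ.*-cong (ℚ.toℚᵘ-fromℚᵘ (mkℚᵘ (+ b) μ)) (toℚᵘ-ℕtoℚ (suc μ)))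
      (ℚᵘ.≃-trans (*≡* integral) (ℚᵘ.≃-sym (toℚᵘ-ℕtoℚ b)))))
    where
    open ≡-Reasoning
    integral : (+ b ℤ.* + suc μ) ℤ.* + 1 ≡ + b ℤ.* + (suc μ * 1)
    integral = begin
      (+ b ℤ.* + suc μ) ℤ.* + 1  ≡⟨ ℤ.*-identityʳ _ ⟩
      + b ℤ.* + suc μ            ≡⟨ cong (λ d → + b ℤ.* + d) (*-identityʳ (suc μ)) ⟨
      + b ℤ.* + (suc μ * 1)      ∎

  frac-nonNeg : ∀ a b → 0ℚ ℚ.≤ frac a b
  frac-nonNeg a zero    = ℚ.≤-refl
  frac-nonNeg a (suc b) = ℚ.nonNegative⁻¹ _ {{ℚ.normalize-nonNeg a (suc b)}}

  divℚ-*-cancel : ∀ p q → q ≢ 0ℚ → divℚ p q ℚ.* q ≡ p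
  divℚ-*-cancel p q q≢0 with q ℚ.≟ 0ℚ
  ... | yes q≡0 = contradiction q≡0 q≢0
  ... | no  q≢0 = begin
    p ℚ.* ℚ.1/ q ℚ.* q      ≡⟨ ℚ.*-assoc p (ℚ.1/ q) q ⟩
    p ℚ.* (ℚ.1/ q ℚ.* q)    ≡⟨ cong (p ℚ.*_) (ℚ.*-inverseˡ q) ⟩
    p ℚ.* 1ℚ                ≡⟨ ℚ.*-identityʳ p ⟩
    p                       ∎
    where
    open ≡-Reasoning
    instance
      _ : NonZero q
      _ = ≢-nonZero q≢0

  FewLions : ℕ → ℚ → ℕ → Set
  FewLions n g k = ℕtoℚ k ℚ.≤ divℚ (g ℚ.* ℕtoℚ n) (ℕtoℚ 4 ℚ.+ g)

  FewLions⇒k*4≤g*[n∸k] : ∀ {n g k} → 0ℚ ℚ.≤ g → FewLions n g k → ℕtoℚ (k * 4) ℚ.≤ g ℚ.* ℕtoℚ (n ∸ k)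
  FewLions⇒k*4≤g*[n∸k] {n} {g} {k} g≥0 few = +-cancelˡ-≤ℚ (g ℚ.* ℕtoℚ k) (begin
    g ℚ.* ℕtoℚ k ℚ.+ ℕtoℚ (k * 4)             ≡⟨ ℚ.+-comm (g ℚ.* ℕtoℚ k) _ ⟩
    ℕtoℚ (k * 4) ℚ.+ g ℚ.* ℕtoℚ k             ≡⟨ cong₂ ℚ._+_ (ℕtoℚ-homo-* k 4) (ℚ.*-comm g (ℕtoℚ k)) ⟩
    ℕtoℚ k ℚ.* ℕtoℚ 4 ℚ.+ ℕtoℚ k ℚ.* g        ≡⟨ ℚ.*-distribˡ-+ (ℕtoℚ k) (ℕtoℚ 4) g ⟨
    ℕtoℚ k ℚ.* D                              ≤⟨ ℚ.*-monoʳ-≤-nonNeg D {{nonNegative D≥0}} few ⟩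
    divℚ (g ℚ.* ℕtoℚ n) D ℚ.* D               ≡⟨ divℚ-*-cancel (g ℚ.* ℕtoℚ n) D D≢0 ⟩
    g ℚ.* ℕtoℚ n                              ≤⟨ ℚ.*-monoˡ-≤-nonNeg g {{nonNegative g≥0}} (ℕtoℚ-mono-≤ (m≤n+m∸n n k)) ⟩
    g ℚ.* ℕtoℚ (k + (n ∸ k))                  ≡⟨ cong (g ℚ.*_) (ℕtoℚ-homo-+ k (n ∸ k)) ⟩
    g ℚ.* (ℕtoℚ k ℚ.+ ℕtoℚ (n ∸ k))           ≡⟨ ℚ.*-distribˡ-+ g (ℕtoℚ k) (ℕtoℚ (n ∸ k)) ⟩
    g ℚ.* ℕtoℚ k ℚ.+ g ℚ.* ℕtoℚ (n ∸ k)       ∎)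
    where
    open ℚ.≤-Reasoning
    D = ℕtoℚ 4 ℚ.+ g
    4≤D : ℕtoℚ 4 ℚ.≤ D
    4≤D = subst (ℚ._≤ D) (ℚ.+-identityʳ (ℕtoℚ 4)) (ℚ.+-monoʳ-≤ (ℕtoℚ 4) g≥0)
    D≥0 : 0ℚ ℚ.≤ D
    D≥0 = ℚ.≤-trans (ℕtoℚ-nonNeg 4) 4≤D
    D≢0 : D ≢ 0ℚ
    D≢0 D≡0 with ℕtoℚ-cancel-≤ {4} {0} (subst (ℕtoℚ 4 ℚ.≤_) D≡0 4≤D)
    ... | ()
    +-cancelˡ-≤ℚ : ∀ r {p q} → r ℚ.+ p ℚ.≤ r ℚ.+ q → p ℚ.≤ q
    +-cancelˡ-≤ℚ r {p} {q} r+p≤r+q = subst₂ ℚ._≤_ (-r+[r+x]≡x p) (-r+[r+x]≡x q) (ℚ.+-monoʳ-≤ (ℚ.- r) r+p≤r+q)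
      where
      -r+[r+x]≡x : ∀ x → ℚ.- r ℚ.+ (r ℚ.+ x) ≡ x
      -r+[r+x]≡x x = trans (sym (ℚ.+-assoc (ℚ.- r) r x)) (trans (cong (ℚ._+ x) (ℚ.+-inverseˡ r)) (ℚ.+-identityˡ x))

  g≤b/d⇒x*d≤b*N : ∀ g b μ x N → g ℚ.≤ frac b (suc μ) → ℕtoℚ x ℚ.≤ g ℚ.* ℕtoℚ N → x * suc μ ≤ b * N
  g≤b/d⇒x*d≤b*N g b μ x N g≤b/d x≤gN = ℕtoℚ-cancel-≤ (begin
    ℕtoℚ (x * suc μ)                  ≡⟨ ℕtoℚ-homo-* x (suc μ) ⟩
    ℕtoℚ x ℚ.* d                      ≤⟨ ℚ.*-monoʳ-≤-nonNeg d {{nonNegative (ℕtoℚ-nonNeg (suc μ))}} x≤gN ⟩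
    g ℚ.* ℕtoℚ N ℚ.* d                ≡⟨ ℚ.*-assoc g (ℕtoℚ N) d ⟩
    g ℚ.* (ℕtoℚ N ℚ.* d)              ≡⟨ cong (g ℚ.*_) (ℚ.*-comm (ℕtoℚ N) d) ⟩
    g ℚ.* (d ℚ.* ℕtoℚ N)              ≡⟨ ℚ.*-assoc g d (ℕtoℚ N) ⟨
    g ℚ.* d ℚ.* ℕtoℚ N                ≤⟨ ℚ.*-monoʳ-≤-nonNeg (ℕtoℚ N) {{nonNegative (ℕtoℚ-nonNeg N)}}
                                           (ℚ.*-monoʳ-≤-nonNeg d {{nonNegative (ℕtoℚ-nonNeg (suc μ))}} g≤b/d) ⟩
    frac b (suc μ) ℚ.* d ℚ.* ℕtoℚ N   ≡⟨ cong (ℚ._* ℕtoℚ N) (frac-*-cancel b μ) ⟩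
    ℕtoℚ b ℚ.* ℕtoℚ N                 ≡⟨ ℕtoℚ-homo-* b N ⟨
    ℕtoℚ (b * N)                      ∎)
    where
    open ℚ.≤-Reasoning
    d = ℕtoℚ (suc μ)

  module _ {n} (G : Graph n) {g} (cheeger : IsCheegerConstant G g) {k} (few : FewLions n g k) where

    small-set-expansion : ∀ S → ∣ S ∣ + ∣ S ∣ ≤ n → k * 4 * ∣ S ∣ ≤ ∣ boundary G S ∣ * (n ∸ k)
    small-set-expansion S small with ∣ S ∣ in ∣S∣≡
    ... | zero  = ≤-trans (≤-reflexive (*-zeroʳ (k * 4))) z≤n
    ... | suc μ = g≤b/d⇒x*d≤b*N g ∣ boundary G S ∣ μ (k * 4) (n ∸ k)
                    (subst (λ d → g ℚ.≤ frac ∣ boundary G S ∣ d) min≡ (proj₂ cheeger S proper))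
                    (FewLions⇒k*4≤g*[n∸k] {n} {g} {k} g≥0 few)
      where
      g≥0 : 0ℚ ℚ.≤ g
      g≥0 with proj₁ cheeger
      ... | S₀ , _ , refl = frac-nonNeg ∣ boundary G S₀ ∣ (∣ S₀ ∣ ⊓ ∣ ∁ S₀ ∣)
      min≡ : ∣ S ∣ ⊓ ∣ ∁ S ∣ ≡ suc μ
      min≡ = begin-equality
        ∣ S ∣ ⊓ ∣ ∁ S ∣      ≡⟨ cong₂ _⊓_ ∣S∣≡ (trans (∣∁p∣≡n∸∣p∣ S) (cong (n ∸_) ∣S∣≡)) ⟩
        suc μ ⊓ (n ∸ suc μ)  ≡⟨ m≤n⇒m⊓n≡m (m+n≤o⇒m≤o∸n (suc μ) small) ⟩
        suc μ                ∎
        where open ≤-Reasoning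
      proper : Proper S
      proper = (λ S≡⊥ → 0≢1+n (trans (sym (∣⊥∣≡0 n)) (trans (cong ∣_∣ (sym S≡⊥)) ∣S∣≡)))
             , (λ S≡⊤ → <⇒≱ (m<m+n (suc μ) z<s)
                  (subst (suc μ + suc μ ≤_) (trans (sym (∣⊤∣≡n n)) (trans (cong ∣_∣ (sym S≡⊤)) ∣S∣≡)) small))

  ⌊n/2⌋+⌊n/2⌋≤n : ∀ n → ⌊ n /2⌋ + ⌊ n /2⌋ ≤ n
  ⌊n/2⌋+⌊n/2⌋≤n 0             = z≤n
  ⌊n/2⌋+⌊n/2⌋≤n 1             = z≤n
  ⌊n/2⌋+⌊n/2⌋≤n (suc (suc n)) =
    s≤s (subst (_≤ suc n) (sym (+-suc ⌊ n /2⌋ ⌊ n /2⌋)) (s≤s (⌊n/2⌋+⌊n/2⌋≤n n)))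

  n≤1+⌊n/2⌋+⌊n/2⌋ : ∀ n → n ≤ suc (⌊ n /2⌋ + ⌊ n /2⌋)
  n≤1+⌊n/2⌋+⌊n/2⌋ 0             = z≤n
  n≤1+⌊n/2⌋+⌊n/2⌋ 1             = s≤s z≤n
  n≤1+⌊n/2⌋+⌊n/2⌋ (suc (suc n)) =
    s≤s (subst (suc n ≤_) (cong suc (sym (+-suc ⌊ n /2⌋ ⌊ n /2⌋))) (s≤s (n≤1+⌊n/2⌋+⌊n/2⌋ n)))

  1≤n⇒⌊n/2⌋<n : ∀ {n} → 1 ≤ n → ⌊ n /2⌋ < n
  1≤n⇒⌊n/2⌋<n {suc n} _ = ⌊n/2⌋<n n

  x+x≤1+m+m⇒x≤m : ∀ {x m} → x + x ≤ suc (m + m) → x ≤ m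
  x+x≤1+m+m⇒x≤m {x} {m} x+x≤ = ≮⇒≥ λ m<x →
    1+n≰n (≤-trans (≤-reflexive (cong suc (sym (+-suc m m)))) (≤-trans (+-mono-≤ m<x m<x) x+x≤))

  y≤m⇒b+1+m≤x+y⇒b<x : ∀ {x y m b} → y ≤ m → b + suc m ≤ x + y → b < x
  y≤m⇒b+1+m≤x+y⇒b<x {x} {y} {m} {b} y≤m b+m<x+y = +-cancelʳ-≤ m (suc b) x (begin
    suc b + m  ≡⟨ +-suc b m ⟨
    b + suc m  ≤⟨ b+m<x+y ⟩
    x + y      ≤⟨ +-monoʳ-≤ x y≤m ⟩
    x + m      ∎)
    where open ≤-Reasoning

  -- With x = b + 1 + p and y = b + 1 + r, the gap x y − (m + 1) b is at least 1 + p + r + p r.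
  [1+m]*b<x*y : ∀ {x y m b} → x ≤ m → y ≤ m → b + suc m ≤ x + y → suc m * b < x * y
  [1+m]*b<x*y {x} {y} {m} {b} x≤m y≤m b+m<x+y
    with m≤n⇒∃[o]m+o≡n (y≤m⇒b+1+m≤x+y⇒b<x y≤m b+m<x+y)
       | m≤n⇒∃[o]m+o≡n (y≤m⇒b+1+m≤x+y⇒b<x x≤m (subst (b + suc m ≤_) (+-comm x y) b+m<x+y))
  ... | p , refl | r , refl = begin-strict
    suc m * b                                            ≤⟨ *-monoˡ-≤ b m<b+2+p+r ⟩
    suc (suc (b + (p + r))) * b                          <⟨ s≤s (m≤m+n _ _) ⟩
    suc (suc (suc (b + (p + r))) * b + (p + r + p * r))  ≡⟨ expand b p r ⟨
    (suc b + p) * (suc b + r)                            ∎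
    where
    open ≤-Reasoning
    expand : ∀ b p r → (suc b + p) * (suc b + r) ≡ suc (suc (suc (b + (p + r))) * b + (p + r + p * r))
    expand = solve-∀
    regroup : ∀ b p r → (suc b + p) + (suc b + r) ≡ b + suc (suc (b + (p + r)))
    regroup = solve-∀
    m<b+2+p+r : suc m ≤ suc (suc (b + (p + r)))
    m<b+2+p+r = +-cancelˡ-≤ b _ _ (subst (b + suc m ≤_) (regroup b p r) b+m<x+y)

  crossing-violates-expansion : ∀ {k c m b N} → c ≤ m → k + k ≤ m → N ≤ suc (m + m) →
                                b + suc m ≤ c + (k + k) → ¬ (k * 4 * c ≤ b * N)
  crossing-violates-expansion {k} {c} {m} {b} {N} c≤m 2k≤m N≤2m+1 b+m<c+2k = <⇒≱ (begin-strict
    b * N                      ≤⟨ *-monoʳ-≤ b N≤2m+1 ⟩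
    b * suc (m + m)            ≤⟨ *-monoʳ-≤ b (s≤s (+-monoʳ-≤ m (n≤1+n m))) ⟩
    b * (suc m + suc m)        ≡⟨ double b m ⟩
    suc m * b + suc m * b      <⟨ +-mono-< bound bound ⟩
    c * (k + k) + c * (k + k)  ≡⟨ quadruple c k ⟩
    k * 4 * c                  ∎)
    where
    open ≤-Reasoning
    bound : suc m * b < c * (k + k)
    bound = [1+m]*b<x*y c≤m 2k≤m b+m<c+2k
    double : ∀ b m → b * (suc m + suc m) ≡ suc m * b + suc m * b
    double = solve-∀
    quadruple : ∀ c k → c * (k + k) + c * (k + k) ≡ k * 4 * c
    quadruple = solve-∀

  module _ {n} (G : Graph n) (2≤n : 2 ≤ n) {g} (cheeger : IsCheegerConstant G g)
           {k} (few : FewLions n g k) (pos : Strategy n k) where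

    open Clearing G pos

    expansion : ∀ S → ∣ S ∣ + ∣ S ∣ ≤ n → k * 4 * ∣ S ∣ ≤ ∣ boundary G S ∣ * (n ∸ k)
    expansion = small-set-expansion G cheeger {k} few

    k*4≤n : k * 4 ≤ n
    k*4≤n = begin
      k * 4                           ≡⟨ *-identityʳ (k * 4) ⟨
      k * 4 * 1                       ≡⟨ cong (k * 4 *_) (∣⁅x⁆∣≡1 v) ⟨
      k * 4 * ∣ ⁅ v ⁆ ∣               ≤⟨ expansion ⁅ v ⁆ (subst (λ s → s + s ≤ n) (sym (∣⁅x⁆∣≡1 v)) 2≤n) ⟩
      ∣ boundary G ⁅ v ⁆ ∣ * (n ∸ k)  ≤⟨ *-mono-≤ ∣∂⁅v⁆∣≤1 (m∸n≤m n k) ⟩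
      1 * n                           ≡⟨ *-identityˡ n ⟩
      n                               ∎
      where
      open ≤-Reasoning
      v : Fin n
      v = fromℕ< (≤-trans (s≤s z≤n) 2≤n)
      ∣∂⁅v⁆∣≤1 : ∣ boundary G ⁅ v ⁆ ∣ ≤ 1
      ∣∂⁅v⁆∣≤1 = ≤-trans (p⊆q⇒∣p∣≤∣q∣ (boundary⊆ G ⁅ v ⁆)) (≤-reflexive (∣⁅x⁆∣≡1 v))

    k+k≤⌊n/2⌋ : k + k ≤ ⌊ n /2⌋
    k+k≤⌊n/2⌋ = x+x≤1+m+m⇒x≤m (≤-trans (≤-reflexive (quadruple k)) (≤-trans k*4≤n (n≤1+⌊n/2⌋+⌊n/2⌋ n)))
      where
      quadruple : ∀ k → (k + k) + (k + k) ≡ k * 4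
      quadruple = solve-∀

    ∣C∣≤⌊n/2⌋ : ∀ t → ∣ C t ∣ ≤ ⌊ n /2⌋
    ∣C∣≤⌊n/2⌋ zero    = ≤-trans ∣C0∣≤k (≤-trans (m≤m+n k k) k+k≤⌊n/2⌋)
    ∣C∣≤⌊n/2⌋ (suc t) with ∣ C (suc t) ∣ ≤? ⌊ n /2⌋
    ... | yes still-small = still-small
    ... | no  crossed     = contradiction
      (expansion (C t) (≤-trans (+-mono-≤ small small) (⌊n/2⌋+⌊n/2⌋≤n n)))
      (crossing-violates-expansion {k} small k+k≤⌊n/2⌋ (≤-trans (m∸n≤m n k) (n≤1+⌊n/2⌋+⌊n/2⌋ n))
        (≤-trans (+-monoʳ-≤ ∣ boundary G (C t) ∣ (≰⇒> crossed)) (∣∂C∣+∣C-suc∣≤∣C∣+2k t)))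
      where
      small : ∣ C t ∣ ≤ ⌊ n /2⌋
      small = ∣C∣≤⌊n/2⌋ t

    never-cleared : ∀ t → ¬ ClearsAt G pos t
    never-cleared t clears = <⇒≱ (1≤n⇒⌊n/2⌋<n (≤-trans (s≤s z≤n) 2≤n)) (begin
      n          ≡⟨ ∣⊤∣≡n n ⟨
      ∣ ⊤ {n} ∣  ≤⟨ p⊆q⇒∣p∣≤∣q∣ {p = ⊤} (λ {v} _ → from ∈C⇔ (clears v)) ⟩
      ∣ C t ∣    ≤⟨ ∣C∣≤⌊n/2⌋ t ⟩
      ⌊ n /2⌋    ∎)
      where open ≤-Reasoning

open import Data.Nat using (ℕ; _≤_)
open import Data.Rational using (ℚ; _+_; _*_) renaming (_≤_ to _≤ℚ_)
open import Relation.Nullary using (¬_)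

mainTheorem1 : (n : ℕ) (G : Graph n) → 2 ≤ n → Connected G →
    (g : ℚ) → IsCheegerConstant G g →
    (k : ℕ) → ℕtoℚ k ≤ℚ divℚ (g * ℕtoℚ n) (ℕtoℚ 4 + g) →
    (pos : Strategy n k) → ValidStrategy G pos →
    (t : ℕ) → ¬ ClearsAt G pos t
mainTheorem1 n G 2≤n _ g cheeger k few pos _ = never-cleared G 2≤n cheeger few pos
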